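{- For every composition $\alpha\models n$, the number of standard immaculate tableaux of shape $\alpha$ is \[ K_{\alpha,1^n} = \frac{n!}{\prod_{c\in\alpha} h_\alpha(c)}, \] where the product is over all cells $c=(i,j)$ with $1\le i\le\ell(\alpha)$, $1\le j\le\alpha_i$.
   Context: The diagram of a composition $\alpha=(\alpha_1,\dots,\alpha_\ell)$ has $\alpha_i$ left-justified cells in row $i$ (row 1 on top); cell $(i,j)$ is in row $i$, column $j$. A standard immaculate tableau of shape $\alpha\models n$ is a filling of the diagram by $1,\dots,n$, each used once, such that each row increases left to right and the first column increases top to bottom (no other column conditions). The hook of a cell is $h_\alpha(i,1)=\alpha_i+\alpha_{i+1}+\dots+\alpha_\ell$ for cells in the first column, and $h_\alpha(i,j)=\alpha_i-j+1$ for $j>1$. -}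

module Defs where

open import Data.Nat using (ℕ; zero; suc; _+_; _*_; _∸_; _<_)
open import Data.Nat.ListAction using (sum; product)

open import Data.Fin using (Fin; toℕ)
open import Data.List using (List; []; _∷_; map; length; lookup; drop; concat; concatMap; allFin; applyUpTo)
open import Data.List.Relation.Unary.All using (All)
open import Data.List.Relation.Unary.Linked using (Linked)
open import Data.List.Relation.Binary.Permutation.Propositional using (_↭_)
open import Data.Product using (_×_; _,_)
open import Relation.Binary.PropositionalEquality using (_≡_)

IsComposition : List ℕ → Set
IsComposition α = All (λ a → 0 < a) α

size : List ℕ → ℕ
size = sum

oneTo : ℕ → List ℕ
oneTo m = applyUpTo suc m

-- hook length of cell (i , j); i is a 0-based row index (row i+1 in the paper),
-- j is the 1-based column index.
--   h(i,1) = α_i + α_{i+1} + … + α_ℓ ;  h(i,j) = α_i - j + 1  for j > 1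
hook : (α : List ℕ) → Fin (length α) → ℕ → ℕ
hook α i 1 = sum (drop (toℕ i) α)
hook α i j = lookup α i ∸ j + 1

cells : (α : List ℕ) → List (Fin (length α) × ℕ)
cells α = concatMap (λ i → map (λ j → (i , j)) (oneTo (lookup α i))) (allFin (length α))

hookProduct : List ℕ → ℕ
hookProduct α = product (map (λ c → hook α (Data.Product.proj₁ c) (Data.Product.proj₂ c)) (cells α))

firstColumn : List (List ℕ) → List ℕ
firstColumn [] = []
firstColumn ([] ∷ rs) = firstColumn rs
firstColumn ((x ∷ _) ∷ rs) = x ∷ firstColumn rs

record IsSIT (α : List ℕ) (rows : List (List ℕ)) : Set where
  field
    shape     : map length rows ≡ α
    entries   : concat rows ↭ oneTo (size α)
    rowsInc   : All (Linked _<_) rows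
    firstCol  : Linked _<_ (firstColumn rows)

-- The least entry of a standard immaculate tableau sits in the top left corner:
-- it starts its row, and the first column increases.  The rest of the first row
-- is then an arbitrary (α₁ − 1)-element subset of the remaining n − 1 entries,
-- and the lower rows form an immaculate tableau of shape (α₂ , … , α_ℓ) on the
-- complementary entries.  So K_α = C(n − 1, α₁ − 1) · K_(α₂ , … , α_ℓ), while the
-- first row contributes the hooks n , α₁ − 1 , … , 1 to ∏ h_α; the identity
-- K_α · ∏ h_α(c) = n! follows by induction on the number of rows.
module Submission where

open import Defs
open import Data.Empty using (⊥-elim)
open import Data.Fin using (Fin) renaming (zero to fzero; suc to fsuc)
open import Data.List
  using (List; []; _∷_; _++_; map; length; concat; concatMap; allFin; tabulate; lookup; applyUpTo)
open import Data.List.Properties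
  using ( length-++; length-map; length-applyUpTo; ∷-injective; ∷-injectiveʳ; ++-assoc
        ; map-++; map-∘; map-cong; map-applyUpTo; map-tabulate; tabulate-cong)
open import Data.List.Membership.Propositional using (_∈_; find; lose)
open import Data.List.Membership.Propositional.Properties
  using (∈-map⁺; ∈-map⁻; ∈-++⁺ˡ; ∈-++⁺ʳ; ∈-++⁻; ∈-∃++; ∈-concatMap⁺; ∈-concatMap⁻)
open import Data.List.Relation.Unary.Any using (here; there)
open import Data.List.Relation.Unary.All as All using (All; []; _∷_)
import Data.List.Relation.Unary.All.Properties as All
open import Data.List.Relation.Unary.AllPairs as AllPairs using (AllPairs; []; _∷_)
import Data.List.Relation.Unary.AllPairs.Properties as AllPairs
open import Data.List.Relation.Unary.Linked.Properties using (Linked⇒AllPairs; AllPairs⇒Linked)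
open import Data.List.Relation.Unary.Unique.Propositional using (Unique)
import Data.List.Relation.Unary.Unique.Propositional.Properties as Unique
open import Data.List.Relation.Binary.Disjoint.Propositional using (Disjoint)
import Data.List.Relation.Binary.Pointwise as Pointwise
open import Data.List.Relation.Binary.Permutation.Propositional using (_↭_; ↭-refl; ↭-sym; ↭-trans; prep)
open import Data.List.Relation.Binary.Permutation.Propositional.Properties
  using (drop-∷; shift; drop-mid; ↭-empty-inv; ∈-resp-↭; ++⁺ˡ)
open import Data.List.Relation.Ternary.Interleaving.Propositional
  using (Interleaving; []; consˡ; consʳ; right; toPermutation)
open import Data.List.Relation.Ternary.Interleaving.Properties using (interleave-length)
open import Data.Nat using (ℕ; zero; suc; _+_; _*_; _∸_; _!; _<_; _≟_; z≤n; s≤s)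
open import Data.Nat.Properties
  using (<-asym; <-trans; <⇒≢; +-comm; *-distribʳ-+; m+n∸m≡n; m≤m+n; +-cancelˡ-≡; suc-injective)
open import Data.Nat.ListAction using (sum; product)
open import Data.Nat.ListAction.Properties using (product-++)
open import Data.Nat.Combinatorics using (_C_; nCk+nC[k+1]≡[n+1]C[k+1]; k![n∸k]!∣n!)
open import Data.Nat.Combinatorics.Specification using (k>n⇒nCk≡0; nCk≡n!/k![n-k]!)
open import Data.Nat.DivMod using (m/n*n≡m)
open import Data.Nat.Tactic.RingSolver using (solve-∀)
open import Data.Product using (Σ; ∃-syntax; _×_; _,_; proj₁; proj₂; map₁; map₂)
open import Data.Sum using (inj₁; inj₂)
open import Function using (_∘_; id)
open import Function.Bundles using (_⇔_; mk⇔; Equivalence)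
open import Relation.Nullary using (yes; no)
open import Relation.Binary.PropositionalEquality
  using (_≡_; _≢_; refl; sym; trans; cong; cong₂; subst; module ≡-Reasoning)

module _ {a} {A : Set a} where

  All-interleaveˡ : ∀ {p} {P : A → Set p} {l r xs} → Interleaving l r xs → All P xs → All P l
  All-interleaveˡ []        []         = []
  All-interleaveˡ (consˡ i) (px ∷ pxs) = px ∷ All-interleaveˡ i pxs
  All-interleaveˡ (consʳ i) (_  ∷ pxs) = All-interleaveˡ i pxs

  All-interleaveʳ : ∀ {p} {P : A → Set p} {l r xs} → Interleaving l r xs → All P xs → All P r
  All-interleaveʳ []        []         = []
  All-interleaveʳ (consˡ i) (_  ∷ pxs) = All-interleaveʳ i pxs
  All-interleaveʳ (consʳ i) (px ∷ pxs) = px ∷ All-interleaveʳ i pxs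

  AllPairs-interleaveˡ : ∀ {r} {R : A → A → Set r} {l rs xs} →
                         Interleaving l rs xs → AllPairs R xs → AllPairs R l
  AllPairs-interleaveˡ []        []         = []
  AllPairs-interleaveˡ (consˡ i) (px ∷ pxs) = All-interleaveˡ i px ∷ AllPairs-interleaveˡ i pxs
  AllPairs-interleaveˡ (consʳ i) (_  ∷ pxs) = AllPairs-interleaveˡ i pxs

  AllPairs-interleaveʳ : ∀ {r} {R : A → A → Set r} {l rs xs} →
                         Interleaving l rs xs → AllPairs R xs → AllPairs R rs
  AllPairs-interleaveʳ []        []         = []
  AllPairs-interleaveʳ (consˡ i) (_  ∷ pxs) = AllPairs-interleaveʳ i pxs
  AllPairs-interleaveʳ (consʳ i) (px ∷ pxs) = All-interleaveʳ i px ∷ AllPairs-interleaveʳ i pxs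

  interleavings : ℕ → List A → List (List A × List A)
  interleavings zero    xs       = ([] , xs) ∷ []
  interleavings (suc k) []       = []
  interleavings (suc k) (x ∷ xs) =
    map (map₁ (x ∷_)) (interleavings k xs) ++ map (map₂ (x ∷_)) (interleavings (suc k) xs)

  ∈-interleavings⁻ : ∀ k xs {l r} → (l , r) ∈ interleavings k xs → Interleaving l r xs × length l ≡ k
  ∈-interleavings⁻ zero    xs       (here refl) = right (Pointwise.refl refl) , refl
  ∈-interleavings⁻ (suc k) (x ∷ xs) l,r∈
    with ∈-++⁻ (map (map₁ (x ∷_)) (interleavings k xs)) l,r∈
  ... | inj₁ l,r∈ˡ with _ , l,r∈′ , refl ← ∈-map⁻ _ l,r∈ˡ =
    let i , len = ∈-interleavings⁻ k xs l,r∈′ in consˡ i , cong suc len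
  ... | inj₂ l,r∈ʳ with _ , l,r∈′ , refl ← ∈-map⁻ _ l,r∈ʳ =
    let i , len = ∈-interleavings⁻ (suc k) xs l,r∈′ in consʳ i , len

  ∈-interleavings⁺ : ∀ {l r xs} → Interleaving l r xs → (l , r) ∈ interleavings (length l) xs
  ∈-interleavings⁺ []        = here refl
  ∈-interleavings⁺ (consˡ i) = ∈-++⁺ˡ (∈-map⁺ (map₁ (_ ∷_)) (∈-interleavings⁺ i))
  ∈-interleavings⁺ {l = []} (consʳ i) with here refl ← ∈-interleavings⁺ i = here refl
  ∈-interleavings⁺ {l = _ ∷ _} (consʳ i) = ∈-++⁺ʳ _ (∈-map⁺ (map₂ (_ ∷_)) (∈-interleavings⁺ i))

  length-interleavings : ∀ k xs → length (interleavings k xs) ≡ length xs C k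
  length-interleavings zero    xs       = refl
  length-interleavings (suc k) []       = sym (k>n⇒nCk≡0 {0} {suc k} (s≤s z≤n))
  length-interleavings (suc k) (x ∷ xs) = begin
    length (map (map₁ (x ∷_)) (interleavings k xs) ++ map (map₂ (x ∷_)) (interleavings (suc k) xs))
      ≡⟨ length-++ (map (map₁ (x ∷_)) (interleavings k xs)) ⟩
    length (map (map₁ (x ∷_)) (interleavings k xs)) + length (map (map₂ (x ∷_)) (interleavings (suc k) xs))
      ≡⟨ cong₂ _+_ (length-map _ (interleavings k xs)) (length-map _ (interleavings (suc k) xs)) ⟩
    length (interleavings k xs) + length (interleavings (suc k) xs)
      ≡⟨ cong₂ _+_ (length-interleavings k xs) (length-interleavings (suc k) xs) ⟩
    length xs C k + length xs C suc k
      ≡⟨ nCk+nC[k+1]≡[n+1]C[k+1] (length xs) k ⟩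
    suc (length xs) C suc k ∎
    where open ≡-Reasoning

  interleavings-distinctˡ : ∀ k {xs} → Unique xs →
                            AllPairs (λ p q → proj₁ p ≢ proj₁ q) (interleavings k xs)
  interleavings-distinctˡ zero             _            = [] ∷ []
  interleavings-distinctˡ (suc k) {[]}     _            = []
  interleavings-distinctˡ (suc k) {x ∷ xs} (x∉xs ∷ xs!) =
    AllPairs.++⁺
      (AllPairs.map⁺ (AllPairs.map (λ T≢T′ → T≢T′ ∘ ∷-injectiveʳ) (interleavings-distinctˡ k xs!)))
      (AllPairs.map⁺ (interleavings-distinctˡ (suc k) xs!))
      (All.tabulate λ p∈ → All.tabulate λ q∈ → contains-x≢avoids-x p∈ q∈)
    where
    contains-x≢avoids-x : ∀ {p q} → p ∈ map (map₁ (x ∷_)) (interleavings k xs) →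
              q ∈ map (map₂ (x ∷_)) (interleavings (suc k) xs) → proj₁ p ≢ proj₁ q
    contains-x≢avoids-x p∈ q∈ eq
      with _ , _ , refl ← ∈-map⁻ _ p∈ | _ , q′∈ , refl ← ∈-map⁻ _ q∈ =
      All.head (subst (All (x ≢_)) (sym eq)
        (All-interleaveˡ (proj₁ (∈-interleavings⁻ (suc k) xs q′∈)) x∉xs)) refl

module _ {a b} {A : Set a} {B : Set b} where

  product-map-concatMap : (h : B → ℕ) (g : A → List B) (xs : List A) →
    product (map h (concatMap g xs)) ≡ product (map (λ x → product (map h (g x))) xs)
  product-map-concatMap h g []       = refl
  product-map-concatMap h g (x ∷ xs) = begin
    product (map h (g x ++ concatMap g xs))
      ≡⟨ cong product (map-++ h (g x) (concatMap g xs)) ⟩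
    product (map h (g x) ++ map h (concatMap g xs))
      ≡⟨ product-++ (map h (g x)) (map h (concatMap g xs)) ⟩
    product (map h (g x)) * product (map h (concatMap g xs))
      ≡⟨ cong (product (map h (g x)) *_) (product-map-concatMap h g xs) ⟩
    product (map h (g x)) * product (map (λ x → product (map h (g x))) xs) ∎
    where open ≡-Reasoning

  length-concatMap-uniform : (f : A → List B) {h c : ℕ} (xs : List A) →
    All (λ x → length (f x) * h ≡ c) xs → length (concatMap f xs) * h ≡ length xs * c
  length-concatMap-uniform f         []       []       = refl
  length-concatMap-uniform f {h} {c} (x ∷ xs) (e ∷ es) = begin
    length (f x ++ concatMap f xs) * h             ≡⟨ cong (_* h) (length-++ (f x)) ⟩
    (length (f x) + length (concatMap f xs)) * h   ≡⟨ *-distribʳ-+ h (length (f x)) _ ⟩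
    length (f x) * h + length (concatMap f xs) * h ≡⟨ cong₂ _+_ e (length-concatMap-uniform f xs es) ⟩
    c + length xs * c                              ∎
    where open ≡-Reasoning

Ascending : List ℕ → Set
Ascending = AllPairs _<_

oneTo-ascending : ∀ n → Ascending (oneTo n)
oneTo-ascending n = AllPairs.applyUpTo⁺₁ suc n (λ i<j _ → s≤s i<j)

least-↭-unique : ∀ {x y xs ys} → x ∷ xs ↭ y ∷ ys → All (x <_) xs → All (y <_) ys → x ≡ y
least-↭-unique x∷xs↭y∷ys x<xs y<ys
  with ∈-resp-↭ (↭-sym x∷xs↭y∷ys) (here refl) | ∈-resp-↭ x∷xs↭y∷ys (here refl)
... | here y≡x   | _          = sym y≡x
... | there _    | here x≡y   = x≡y
... | there y∈xs | there x∈ys = ⊥-elim (<-asym (All.lookup x<xs y∈xs) (All.lookup y<ys x∈ys))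

ascending-↭-interleaving : ∀ {S T U} → Ascending S → Ascending T → T ++ U ↭ S →
                           ∃[ R ] Interleaving T R S × U ↭ R
ascending-↭-interleaving {S}     {[]}    _ _ U↭S = S , right (Pointwise.refl refl) , U↭S
ascending-↭-interleaving {[]}    {_ ∷ _} _ _ T++U↭[] with () ← ↭-empty-inv T++U↭[]
ascending-↭-interleaving {s ∷ S} {t ∷ T} {U} (s<S ∷ S↑) (t<T ∷ T↑) t∷T++U↭s∷S with t ≟ s
... | yes refl =
  let R , i , U↭R = ascending-↭-interleaving S↑ T↑ (drop-∷ t∷T++U↭s∷S) in R , consˡ i , U↭R
... | no t≢s with ∈-∃++ s∈U
  where
  s<t : s < t
  s<t with ∈-resp-↭ t∷T++U↭s∷S (here refl)
  ... | here t≡s  = ⊥-elim (t≢s t≡s)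
  ... | there t∈S = All.lookup s<S t∈S
  s∈U : s ∈ U
  s∈U with ∈-resp-↭ (↭-sym t∷T++U↭s∷S) (here refl)
  ... | here s≡t = ⊥-elim (t≢s (sym s≡t))
  ... | there s∈T++U with ∈-++⁻ T s∈T++U
  ...   | inj₁ s∈T = ⊥-elim (<-asym s<t (All.lookup t<T s∈T))
  ...   | inj₂ s∈U = s∈U
... | U₁ , U₂ , refl =
  let R , i , U₁++U₂↭R = ascending-↭-interleaving S↑ (t<T ∷ T↑) t∷T++U₁++U₂↭S
  in s ∷ R , consʳ i , ↭-trans (shift s U₁ U₂) (prep s U₁++U₂↭R)
  where
  t∷T++U₁++U₂↭S : (t ∷ T) ++ U₁ ++ U₂ ↭ S
  t∷T++U₁++U₂↭S = subst (_↭ S) (++-assoc (t ∷ T) U₁ U₂)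
    (drop-mid ((t ∷ T) ++ U₁) []
      (subst (_↭ s ∷ S) (sym (++-assoc (t ∷ T) U₁ (s ∷ U₂))) t∷T++U↭s∷S))

∈-firstColumn⇒∈-concat : ∀ rows {z} → z ∈ firstColumn rows → z ∈ concat rows
∈-firstColumn⇒∈-concat ([] ∷ rows)      z∈          = ∈-firstColumn⇒∈-concat rows z∈
∈-firstColumn⇒∈-concat ((w ∷ r) ∷ rows) (here refl) = here refl
∈-firstColumn⇒∈-concat ((w ∷ r) ∷ rows) (there z∈)  =
  there (∈-++⁺ʳ r (∈-firstColumn⇒∈-concat rows z∈))

firstColumn-bound⇒concat-bound : ∀ {y} rows → All Ascending rows →
                                 All (y <_) (firstColumn rows) → All (y <_) (concat rows)
firstColumn-bound⇒concat-bound []               _                   _          = []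
firstColumn-bound⇒concat-bound ([] ∷ rows)      (_ ∷ rows↑)         y<col      =
  firstColumn-bound⇒concat-bound rows rows↑ y<col
firstColumn-bound⇒concat-bound ((w ∷ r) ∷ rows) ((w<r ∷ _) ∷ rows↑) (y<w ∷ y<col) =
  y<w ∷ All.++⁺ (All.map (<-trans y<w) w<r) (firstColumn-bound⇒concat-bound rows rows↑ y<col)

record IsImmaculateTableau (α S : List ℕ) (rows : List (List ℕ)) : Set where
  field
    shape                : map length rows ≡ α
    entries              : concat rows ↭ S
    rowsAscending        : All Ascending rows
    firstColumnAscending : Ascending (firstColumn rows)

IsSIT⇔IsImmaculateTableau : ∀ {α rows} → IsSIT α rows ⇔ IsImmaculateTableau α (oneTo (size α)) rows
IsSIT⇔IsImmaculateTableau = mk⇔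
  (λ t → record
    { shape                = IsSIT.shape t
    ; entries              = IsSIT.entries t
    ; rowsAscending        = All.map (Linked⇒AllPairs <-trans) (IsSIT.rowsInc t)
    ; firstColumnAscending = Linked⇒AllPairs <-trans (IsSIT.firstCol t) })
  (λ t → record
    { shape    = IsImmaculateTableau.shape t
    ; entries  = IsImmaculateTableau.entries t
    ; rowsInc  = All.map AllPairs⇒Linked (IsImmaculateTableau.rowsAscending t)
    ; firstCol = AllPairs⇒Linked (IsImmaculateTableau.firstColumnAscending t) })

-- Meant for ascending S, whose head x is then forced into the corner.
tableaux : List ℕ → List ℕ → List (List (List ℕ))
tableaux []          []      = [] ∷ []
tableaux []          (_ ∷ _) = []
tableaux (_ ∷ _)     []      = []
tableaux (zero ∷ α)  (_ ∷ _) = []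
tableaux (suc a ∷ α) (x ∷ S) =
  concatMap (λ p → map ((x ∷ proj₁ p) ∷_) (tableaux α (proj₂ p))) (interleavings a S)

tableaux-sound : ∀ α S {rows} → Ascending S → rows ∈ tableaux α S → IsImmaculateTableau α S rows
tableaux-sound []          []      _ (here refl) = record
  { shape = refl ; entries = ↭-refl ; rowsAscending = [] ; firstColumnAscending = [] }
tableaux-sound (suc a ∷ α) (x ∷ S) (x<S ∷ S↑) rows∈
  with (T , R) , T,R∈ , rows∈′ ← find (∈-concatMap⁻ _ {xs = interleavings a S} rows∈)
  with tab , tab∈ , refl ← ∈-map⁻ _ rows∈′
  with i , refl ← ∈-interleavings⁻ a S T,R∈ = record
  { shape                = cong (suc (length T) ∷_) shape
  ; entries              = prep x (↭-trans (++⁺ˡ T entries) (↭-sym (toPermutation i)))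
  ; rowsAscending        = (All-interleaveˡ i x<S ∷ AllPairs-interleaveˡ i S↑) ∷ rowsAscending
  ; firstColumnAscending =
      All.tabulate (λ z∈ → All.lookup (All-interleaveʳ i x<S)
                             (∈-resp-↭ entries (∈-firstColumn⇒∈-concat tab z∈)))
      ∷ firstColumnAscending
  }
  where open IsImmaculateTableau (tableaux-sound α R (AllPairs-interleaveʳ i S↑) tab∈)

tableaux-complete : ∀ α S {rows} → IsComposition α → Ascending S →
                    IsImmaculateTableau α S rows → rows ∈ tableaux α S
tableaux-complete []          _       {[]}          _ _ t
  with refl ← ↭-empty-inv (↭-sym (IsImmaculateTableau.entries t)) = here refl
tableaux-complete []          _       {_ ∷ _}       _ _ record { shape = () }
tableaux-complete (_ ∷ _)     _       {[]}          _ _ record { shape = () }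
tableaux-complete (zero ∷ _)  _                     (() ∷ _)
tableaux-complete (suc _ ∷ _) _       {[] ∷ _}      _ _ record { shape = () }
tableaux-complete (suc _ ∷ _) []      {(_ ∷ _) ∷ _} _ _ t
  with () ← ↭-empty-inv (IsImmaculateTableau.entries t)
tableaux-complete (suc a ∷ α) (x ∷ S) {(y ∷ T) ∷ rows} (_ ∷ α⁺) (x<S ∷ S↑)
  record { shape = shape ; entries = entries
         ; rowsAscending = (y<T ∷ T↑) ∷ rows↑ ; firstColumnAscending = y<col ∷ col↑ }
  with refl ← least-↭-unique entries
                (All.++⁺ y<T (firstColumn-bound⇒concat-bound rows rows↑ y<col)) x<S
  with R , i , rows↭R ← ascending-↭-interleaving S↑ T↑ (drop-∷ entries)
  with refl , shape′ ← ∷-injective shape =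
  ∈-concatMap⁺ _ (lose (∈-interleavings⁺ i) (∈-map⁺ ((x ∷ T) ∷_)
    (tableaux-complete α R α⁺ (AllPairs-interleaveʳ i S↑) record
      { shape = shape′ ; entries = rows↭R ; rowsAscending = rows↑ ; firstColumnAscending = col↑ })))

tableaux-unique : ∀ α S → Unique S → Unique (tableaux α S)
tableaux-unique []          []      _        = [] ∷ []
tableaux-unique []          (_ ∷ _) _        = []
tableaux-unique (_ ∷ _)     []      _        = []
tableaux-unique (zero ∷ _)  (_ ∷ _) _        = []
tableaux-unique (suc a ∷ α) (x ∷ S) (_ ∷ S!) =
  Unique.concat⁺
    (All.map⁺ (All.tabulate λ {p} p∈ →
      Unique.map⁺ ∷-injectiveʳ
        (tableaux-unique α (proj₂ p) (AllPairs-interleaveʳ (proj₁ (∈-interleavings⁻ a S p∈)) S!))))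
    (AllPairs.map⁺ (AllPairs.map disjoint (interleavings-distinctˡ a S!)))
  where
  disjoint : ∀ {p q} → proj₁ p ≢ proj₁ q →
             Disjoint (map ((x ∷ proj₁ p) ∷_) (tableaux α (proj₂ p)))
                      (map ((x ∷ proj₁ q) ∷_) (tableaux α (proj₂ q)))
  disjoint T≢T′ (v∈ , v∈′) with _ , _ , refl ← ∈-map⁻ _ v∈ | _ , _ , eq ← ∈-map⁻ _ v∈′ =
    T≢T′ (∷-injectiveʳ (proj₁ (∷-injective eq)))

rowHookProduct : (α : List ℕ) → Fin (length α) → ℕ
rowHookProduct α i = product (map (hook α i) (oneTo (lookup α i)))

hookProduct≡product-rowHookProduct : ∀ α →
  hookProduct α ≡ product (map (rowHookProduct α) (allFin (length α)))
hookProduct≡product-rowHookProduct α = trans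
  (product-map-concatMap _ (λ i → map (i ,_) (oneTo (lookup α i))) (allFin (length α)))
  (cong product (map-cong (λ i → cong product (sym (map-∘ (oneTo (lookup α i))))) (allFin (length α))))

-- the hooks of the cells (i , 2) , … , (i , n + 1) of a row of length n + 1
product-armHooks : ∀ n → product (applyUpTo (λ m → n ∸ suc m + 1) n) ≡ n !
product-armHooks zero    = refl
product-armHooks (suc n) = cong₂ _*_ (+-comm n 1) (product-armHooks n)

rowHookProduct-first : ∀ a α → rowHookProduct (suc a ∷ α) fzero ≡ sum (suc a ∷ α) * a !
rowHookProduct-first a α = cong (sum (suc a ∷ α) *_)
  (trans (cong product (map-applyUpTo (suc ∘ suc) (hook (suc a ∷ α) fzero) a)) (product-armHooks a))

hook-∷ : ∀ a α i j → hook (a ∷ α) (fsuc i) j ≡ hook α i j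
hook-∷ a α i zero          = refl
hook-∷ a α i (suc zero)    = refl
hook-∷ a α i (suc (suc j)) = refl

hookProduct-∷ : ∀ a α → hookProduct (suc a ∷ α) ≡ sum (suc a ∷ α) * a ! * hookProduct α
hookProduct-∷ a α = begin
  hookProduct (suc a ∷ α)
    ≡⟨ hookProduct≡product-rowHookProduct (suc a ∷ α) ⟩
  rowHookProduct (suc a ∷ α) fzero * product (map (rowHookProduct (suc a ∷ α)) (tabulate fsuc))
    ≡⟨ cong₂ _*_ (rowHookProduct-first a α) (cong product lowerRows) ⟩
  sum (suc a ∷ α) * a ! * product (map (rowHookProduct α) (allFin (length α)))
    ≡⟨ cong (sum (suc a ∷ α) * a ! *_) (sym (hookProduct≡product-rowHookProduct α)) ⟩
  sum (suc a ∷ α) * a ! * hookProduct α ∎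
  where
  open ≡-Reasoning
  lowerRows : map (rowHookProduct (suc a ∷ α)) (tabulate fsuc) ≡ map (rowHookProduct α) (allFin (length α))
  lowerRows = trans (map-tabulate fsuc _) (trans
    (tabulate-cong (λ i → cong product (map-cong (hook-∷ (suc a) α i) (oneTo (lookup α i)))))
    (sym (map-tabulate id _)))

[a+b]Ca*a!*b!≡[a+b]! : ∀ a b → ((a + b) C a) * (a ! * b !) ≡ (a + b) !
[a+b]Ca*a!*b!≡[a+b]! a b = begin
  ((a + b) C a) * (a ! * b !)           ≡⟨ cong (λ k → ((a + b) C a) * (a ! * k !)) (sym (m+n∸m≡n a b)) ⟩
  ((a + b) C a) * (a ! * (a + b ∸ a) !) ≡⟨ cong (_* (a ! * (a + b ∸ a) !)) (nCk≡n!/k![n-k]! (m≤m+n a b)) ⟩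
  _                                     ≡⟨ m/n*n≡m {{_}} (k![n∸k]!∣n! (m≤m+n a b)) ⟩
  (a + b) !                             ∎
  where open ≡-Reasoning

length-tableaux : ∀ α S → IsComposition α → sum α ≡ length S →
                  length (tableaux α S) * hookProduct α ≡ length S !
length-tableaux []          []      _        _  = refl
length-tableaux (zero ∷ _)  _       (() ∷ _) _
length-tableaux (suc a ∷ α) (x ∷ S) (_ ∷ α⁺) eq = begin
  K * hookProduct (suc a ∷ α)                 ≡⟨ cong (K *_) (hookProduct-∷ a α) ⟩
  K * (suc (a + b) * a ! * H)                 ≡⟨ rearrange K (suc (a + b)) (a !) H ⟩
  suc (a + b) * (a ! * (K * H))               ≡⟨ cong (λ k → suc (a + b) * (a ! * k)) countLowerRows ⟩
  suc (a + b) * (a ! * (((a + b) C a) * b !)) ≡⟨ cong (suc (a + b) *_) (swap (a !) ((a + b) C a) (b !)) ⟩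
  suc (a + b) * (((a + b) C a) * (a ! * b !)) ≡⟨ cong (suc (a + b) *_) ([a+b]Ca*a!*b!≡[a+b]! a b) ⟩
  suc (a + b) !                               ≡⟨ cong _! eq ⟩
  suc (length S) !                            ∎
  where
  open ≡-Reasoning
  b H K : ℕ
  b = sum α
  H = hookProduct α
  K = length (tableaux (suc a ∷ α) (x ∷ S))
  rearrange : ∀ k s f h → k * (s * f * h) ≡ s * (f * (k * h))
  rearrange = solve-∀
  swap : ∀ f c d → f * (c * d) ≡ c * (f * d)
  swap = solve-∀
  lowerRows : ∀ {T R} → (T , R) ∈ interleavings a S → length (tableaux α R) * H ≡ b !
  lowerRows {T} {R} T,R∈ with i , refl ← ∈-interleavings⁻ a S T,R∈ =
    trans (length-tableaux α R α⁺ b≡|R|) (cong _! (sym b≡|R|))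
    where
    b≡|R| : b ≡ length R
    b≡|R| = +-cancelˡ-≡ (length T) b (length R) (trans (suc-injective eq) (interleave-length i))
  countLowerRows : K * H ≡ ((a + b) C a) * b !
  countLowerRows = trans
    (length-concatMap-uniform _ (interleavings a S)
      (All.tabulate λ p∈ → trans (cong (_* H) (length-map _ (tableaux α _))) (lowerRows p∈)))
    (cong (_* b !) (trans (length-interleavings a S) (cong (_C a) (sym (suc-injective eq)))))

proposition3p13 : (α : List ℕ) → IsComposition α →
    Σ (List (List (List ℕ))) (λ L →
      Unique L × ((rows : List (List ℕ)) → IsSIT α rows ⇔ rows ∈ L)
        × (length L * hookProduct α ≡ size α !))
proposition3p13 α α⁺ =
  tableaux α ns ,
  tableaux-unique α ns (AllPairs.map <⇒≢ ns↑) ,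
  (λ rows → mk⇔
    (tableaux-complete α ns α⁺ ns↑ ∘ Equivalence.to IsSIT⇔IsImmaculateTableau)
    (Equivalence.from IsSIT⇔IsImmaculateTableau ∘ tableaux-sound α ns ns↑)) ,
  trans (length-tableaux α ns α⁺ (sym |ns|≡n)) (cong _! |ns|≡n)
  where
  n : ℕ
  n = size α
  ns : List ℕ
  ns = oneTo n
  ns↑ : Ascending ns
  ns↑ = oneTo-ascending n
  |ns|≡n : length ns ≡ n
  |ns|≡n = length-applyUpTo suc n
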